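{- If $f\in\#\mathsf{FA}$, then for every constant $c\in\mathbb{N}$ the functions $\mathbb{1}_{f=c}$, $\mathbb{1}_{f\le c}$ and $\mathbb{1}_{f\ge c}$ are in $\#\mathsf{FA}$, where e.g. $\mathbb{1}_{f=c}(w)=1$ if $f(w)=c$ and $0$ otherwise.
   Context: $\mathbb{N}=\{0,1,2,\dots\}$. An NFA is a tuple $M=(Q,\Sigma,\mathrm{wt},\mathrm{in},\mathrm{out})$ with $Q,\Sigma$ finite, $\mathrm{wt}:Q\times\Sigma\times Q\to\mathbb{N}$, $\mathrm{in},\mathrm{out}:Q\to\mathbb{N}$; on input $w=w_1\cdots w_n$ it outputs $\sum_{q_0,\dots,q_n\in Q}\mathrm{in}(q_0)\prod_{i=1}^n\mathrm{wt}(q_{i-1},w_i,q_i)\mathrm{out}(q_n)$. $\#\mathsf{FA}$ is the set of functions $\Sigma^\star\to\mathbb{N}$ (over finite alphabets $\Sigma$) computed by NFAs. -}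

module Defs where

open import Data.Nat using (ℕ; zero; suc; _+_; _*_)
open import Data.Nat.Properties using (_≟_; _≤?_)
open import Data.Fin as Fin using (Fin)
open import Data.List using (List; []; _∷_)
open import Data.Product using (Σ; ∃)
open import Relation.Binary.PropositionalEquality using (_≡_)
open import Relation.Nullary.Decidable using (Dec; yes; no)

Σ[_] : (n : ℕ) → (Fin n → ℕ) → ℕ
Σ[ zero ] f = 0
Σ[ suc n ] f = f Fin.zero + Σ[ n ] (λ i → f (Fin.suc i))

record NFA (k : ℕ) : Set where
  field
    nstates : ℕ
    wt  : Fin nstates → Fin k → Fin nstates → ℕ
    inw : Fin nstates → ℕ
    out : Fin nstates → ℕ

open NFA public

runFrom : ∀ {k} (M : NFA k) → Fin (nstates M) → List (Fin k) → ℕ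
runFrom M q []      = out M q
runFrom M q (a ∷ w) = Σ[ nstates M ] (λ q′ → wt M q a q′ * runFrom M q′ w)

-- Output of M on w: Σ_{q0..qn} in(q0) Π wt(q_{i-1},w_i,q_i) out(q_n).
⟦_⟧ : ∀ {k} → NFA k → List (Fin k) → ℕ
⟦ M ⟧ w = Σ[ nstates M ] (λ q → inw M q * runFrom M q w)

InSharpFA : ∀ {k} → (List (Fin k) → ℕ) → Set
InSharpFA {k} f = Σ (NFA k) (λ M → ∀ w → ⟦ M ⟧ w ≡ f w)

𝟙[_≡_] : ∀ {k} → (List (Fin k) → ℕ) → ℕ → List (Fin k) → ℕ
𝟙[ f ≡ c ] w with f w ≟ c
... | yes _ = 1
... | no  _ = 0

𝟙[_≤_] : ∀ {k} → (List (Fin k) → ℕ) → ℕ → List (Fin k) → ℕ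
𝟙[ f ≤ c ] w with f w ≤? c
... | yes _ = 1
... | no  _ = 0

𝟙[_≥_] : ∀ {k} → (List (Fin k) → ℕ) → ℕ → List (Fin k) → ℕ
𝟙[ f ≥ c ] w with c ≤? f w
... | yes _ = 1
... | no  _ = 0

module Submission where

-- The output of an NFA on a·w is obtained by pushing the vector of weighted path counts
-- through the transition matrix of a and then running on w. Capping numbers at N = c + 1
-- commutes with sums and products, so the capped count vector evolves deterministically
-- in the finite set {0,…,N}ⁿ and determines the capped output; and each indicator only
-- depends on its argument capped at c + 1. A DFA on capped vectors, read as an NFA with
-- 0/1 weights, therefore computes the indicators.

open import Defs
open import Data.Nat using (ℕ; zero; suc; _+_; _*_; _⊓_; _<_; _^_; s≤s)
open import Data.Nat.Properties
open import Data.Fin as Fin using (Fin; toℕ; fromℕ<; funToFin; finToFun)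
open import Data.Fin.Properties using (toℕ-fromℕ<; finToFun-funToFin)
open import Data.List using (List; []; _∷_)
open import Data.Product using (_×_; _,_)
open import Data.Sum using (inj₁; inj₂)
open import Function using (_∘_)
open import Relation.Binary.PropositionalEquality
open import Relation.Nullary using (¬_; contradiction)
open import Relation.Nullary.Decidable using (Dec; yes; no)
open import Algebra.Properties.Semiring.Sum +-*-semiring
  using (sum; sum-cong-≗; sum-replicate-zero; ∑-comm; *-distribˡ-sum; *-distribʳ-sum)

Σ≡sum : ∀ n (f : Fin n → ℕ) → Σ[ n ] f ≡ sum f
Σ≡sum zero    f = refl
Σ≡sum (suc n) f = cong (f Fin.zero +_) (Σ≡sum n (f ∘ Fin.suc))

InSharpFA-resp : ∀ {k} {f g : List (Fin k) → ℕ} → (∀ w → f w ≡ g w) →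
                 InSharpFA f → InSharpFA g
InSharpFA-resp f≗g (M , M≗f) = M , λ w → trans (M≗f w) (f≗g w)

kronecker : ∀ {n} → Fin n → Fin n → ℕ
kronecker Fin.zero    Fin.zero    = 1
kronecker Fin.zero    (Fin.suc _) = 0
kronecker (Fin.suc _) Fin.zero    = 0
kronecker (Fin.suc i) (Fin.suc j) = kronecker i j

sum-kronecker : ∀ {n} (t : Fin n) (g : Fin n → ℕ) → sum (λ q → kronecker q t * g q) ≡ g t
sum-kronecker {suc n} Fin.zero g = begin
  (g Fin.zero + 0) + sum (λ (_ : Fin n) → 0) ≡⟨ cong (g Fin.zero + 0 +_) (sum-replicate-zero n) ⟩
  (g Fin.zero + 0) + 0                       ≡⟨ cong (_+ 0) (+-identityʳ _) ⟩
  g Fin.zero + 0                             ≡⟨ +-identityʳ _ ⟩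
  g Fin.zero                                 ∎
  where open ≡-Reasoning
sum-kronecker {suc n} (Fin.suc t) g = sum-kronecker t (g ∘ Fin.suc)

module Deterministic {k S : ℕ} (δ : Fin S → Fin k → Fin S) where

  δ* : Fin S → List (Fin k) → Fin S
  δ* s []      = s
  δ* s (a ∷ w) = δ* (δ s a) w

  deterministic : Fin S → (Fin S → ℕ) → NFA k
  deterministic s₀ acc = record
    { nstates = S
    ; wt      = λ s a s′ → kronecker s′ (δ s a)
    ; inw     = λ s → kronecker s s₀
    ; out     = acc
    }

  runFrom-deterministic : ∀ s₀ acc s w → runFrom (deterministic s₀ acc) s w ≡ acc (δ* s w)
  runFrom-deterministic s₀ acc s []      = refl
  runFrom-deterministic s₀ acc s (a ∷ w) = begin
    Σ[ S ] (λ s′ → kronecker s′ (δ s a) * runFrom D s′ w) ≡⟨ Σ≡sum S _ ⟩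
    sum (λ s′ → kronecker s′ (δ s a) * runFrom D s′ w)    ≡⟨ sum-kronecker (δ s a) _ ⟩
    runFrom D (δ s a) w                                   ≡⟨ runFrom-deterministic s₀ acc (δ s a) w ⟩
    acc (δ* (δ s a) w)                                    ∎
    where
    open ≡-Reasoning
    D = deterministic s₀ acc

  deterministic-InSharpFA : ∀ s₀ acc → InSharpFA (λ w → acc (δ* s₀ w))
  deterministic-InSharpFA s₀ acc = deterministic s₀ acc , λ w → begin
    Σ[ S ] (λ s → kronecker s s₀ * runFrom D s w) ≡⟨ Σ≡sum S _ ⟩
    sum (λ s → kronecker s s₀ * runFrom D s w)    ≡⟨ sum-kronecker s₀ _ ⟩
    runFrom D s₀ w                                ≡⟨ runFrom-deterministic s₀ acc s₀ w ⟩
    acc (δ* s₀ w)                                 ∎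
    where
    open ≡-Reasoning
    D = deterministic s₀ acc

module Truncation (N : ℕ) where

  infix 4 _≃_
  _≃_ : ℕ → ℕ → Set
  x ≃ y = x ⊓ N ≡ y ⊓ N

  ≃-⊓ : ∀ x → x ≃ x ⊓ N
  ≃-⊓ x = sym (trans (⊓-assoc x N N) (cong (x ⊓_) (⊓-idem N)))

  +-⊓-absorbˡ : ∀ x y → (x + y) ⊓ N ≡ (x ⊓ N + y) ⊓ N
  +-⊓-absorbˡ x y with ≤-total x N
  ... | inj₁ x≤N rewrite m≤n⇒m⊓n≡m x≤N = refl
  ... | inj₂ N≤x rewrite m≥n⇒m⊓n≡n N≤x =
    trans (m≥n⇒m⊓n≡n (≤-trans N≤x (m≤m+n x y))) (sym (m≥n⇒m⊓n≡n (m≤m+n N y)))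

  *-⊓-absorbˡ : ∀ x y → (x * y) ⊓ N ≡ (x ⊓ N * y) ⊓ N
  *-⊓-absorbˡ x y with ≤-total x N
  ... | inj₁ x≤N rewrite m≤n⇒m⊓n≡m x≤N = refl
  ... | inj₂ N≤x rewrite m≥n⇒m⊓n≡n N≤x with y
  ...   | zero   rewrite *-zeroʳ x | *-zeroʳ N = refl
  ...   | suc y′ =
    trans (m≥n⇒m⊓n≡n (≤-trans N≤x (m≤m*n x (suc y′)))) (sym (m≥n⇒m⊓n≡n (m≤m*n N (suc y′))))

  +-congʳ-≃ : ∀ {x y} z → x ≃ y → x + z ≃ y + z
  +-congʳ-≃ {x} {y} z x≃y =
    trans (+-⊓-absorbˡ x z) (trans (cong (λ t → (t + z) ⊓ N) x≃y) (sym (+-⊓-absorbˡ y z)))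

  *-congʳ-≃ : ∀ {x y} z → x ≃ y → x * z ≃ y * z
  *-congʳ-≃ {x} {y} z x≃y =
    trans (*-⊓-absorbˡ x z) (trans (cong (λ t → (t * z) ⊓ N) x≃y) (sym (*-⊓-absorbˡ y z)))

  +-cong-≃ : ∀ {x x′ y y′} → x ≃ x′ → y ≃ y′ → x + y ≃ x′ + y′
  +-cong-≃ {x} {x′} {y} {y′} x≃x′ y≃y′ = begin
    (x + y) ⊓ N   ≡⟨ +-congʳ-≃ y x≃x′ ⟩
    (x′ + y) ⊓ N  ≡⟨ cong (_⊓ N) (+-comm x′ y) ⟩
    (y + x′) ⊓ N  ≡⟨ +-congʳ-≃ x′ y≃y′ ⟩
    (y′ + x′) ⊓ N ≡⟨ cong (_⊓ N) (+-comm y′ x′) ⟩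
    (x′ + y′) ⊓ N ∎
    where open ≡-Reasoning

  sum-cong-≃ : ∀ {n} {f g : Fin n → ℕ} → (∀ i → f i ≃ g i) → sum f ≃ sum g
  sum-cong-≃ {zero}  f≃g = refl
  sum-cong-≃ {suc n} f≃g = +-cong-≃ (f≃g Fin.zero) (sum-cong-≃ (f≃g ∘ Fin.suc))

  dot-congˡ-≃ : ∀ {n} {u v : Fin n → ℕ} (y : Fin n → ℕ) → (∀ i → u i ≃ v i) →
                sum (λ i → u i * y i) ≃ sum (λ i → v i * y i)
  dot-congˡ-≃ y u≃v = sum-cong-≃ (λ i → *-congʳ-≃ (y i) (u≃v i))

  truncate : ℕ → Fin (suc N)
  truncate x = fromℕ< (s≤s (m⊓n≤n x N))

  toℕ-truncate : ∀ x → toℕ (truncate x) ≃ x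
  toℕ-truncate x = trans (cong (_⊓ N) (toℕ-fromℕ< _)) (sym (≃-⊓ x))

module Forward {k} (M : NFA k) where

  weighted : (Fin (nstates M) → ℕ) → List (Fin k) → ℕ
  weighted u w = sum (λ q → u q * runFrom M q w)

  advance : (Fin (nstates M) → ℕ) → Fin k → Fin (nstates M) → ℕ
  advance u a q′ = sum (λ q → u q * wt M q a q′)

  ⟦⟧≡weighted : ∀ w → ⟦ M ⟧ w ≡ weighted (inw M) w
  ⟦⟧≡weighted w = Σ≡sum (nstates M) _

  weighted-∷ : ∀ u a w → weighted u (a ∷ w) ≡ weighted (advance u a) w
  weighted-∷ u a w = begin
    sum (λ q → u q * Σ[ n ] (λ q′ → W q q′ * r q′))
      ≡⟨ sum-cong-≗ (λ q → cong (u q *_) (Σ≡sum n (λ q′ → W q q′ * r q′))) ⟩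
    sum (λ q → u q * sum (λ q′ → W q q′ * r q′))
      ≡⟨ sum-cong-≗ (λ q → *-distribˡ-sum (u q) (λ q′ → W q q′ * r q′)) ⟩
    sum (λ q → sum (λ q′ → u q * (W q q′ * r q′)))
      ≡⟨ ∑-comm (λ q q′ → u q * (W q q′ * r q′)) ⟩
    sum (λ q′ → sum (λ q → u q * (W q q′ * r q′)))
      ≡⟨ sum-cong-≗ (λ q′ → sum-cong-≗ (λ q → sym (*-assoc (u q) (W q q′) (r q′)))) ⟩
    sum (λ q′ → sum (λ q → u q * W q q′ * r q′))
      ≡⟨ sum-cong-≗ (λ q′ → sym (*-distribʳ-sum (r q′) (λ q → u q * W q q′))) ⟩
    sum (λ q′ → advance u a q′ * r q′)
      ∎
    where
    open ≡-Reasoning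
    n : ℕ
    n = nstates M
    W : Fin n → Fin n → ℕ
    W q q′ = wt M q a q′
    r : Fin n → ℕ
    r q′ = runFrom M q′ w

module TruncatedCounts {k} (M : NFA k) (N : ℕ) where
  open Forward M
  open Truncation N
  open Deterministic

  States : ℕ
  States = suc N ^ nstates M

  encode : (Fin (nstates M) → ℕ) → Fin States
  encode u = funToFin (truncate ∘ u)

  decode : Fin States → Fin (nstates M) → ℕ
  decode s = toℕ ∘ finToFun s

  decode-encode : ∀ u q → decode (encode u) q ≃ u q
  decode-encode u q = trans (cong (λ i → toℕ i ⊓ N) (finToFun-funToFin (truncate ∘ u) q)) (toℕ-truncate (u q))

  δ : Fin States → Fin k → Fin States
  δ s a = encode (advance (decode s) a)

  weighted-≃-δ* : ∀ w {u s} → (∀ q → u q ≃ decode s q) →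
                  weighted u w ≃ weighted (decode (δ* δ s w)) []
  weighted-≃-δ* []      u≃s = dot-congˡ-≃ (out M) u≃s
  weighted-≃-δ* (a ∷ w) {u} {s} u≃s = begin
    weighted u (a ∷ w) ⊓ N                    ≡⟨ cong (_⊓ N) (weighted-∷ u a w) ⟩
    weighted (advance u a) w ⊓ N              ≡⟨ weighted-≃-δ* w advance≃δ ⟩
    weighted (decode (δ* δ (δ s a) w)) [] ⊓ N ∎
    where
    open ≡-Reasoning
    advance≃δ : ∀ q′ → advance u a q′ ≃ decode (δ s a) q′
    advance≃δ q′ = trans (dot-congˡ-≃ (λ q → wt M q a q′) u≃s) (sym (decode-encode _ q′))

∘-InSharpFA : ∀ {k} N (h : ℕ → ℕ) → (∀ x → h x ≡ h (x ⊓ N)) →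
              {f : List (Fin k) → ℕ} → InSharpFA f → InSharpFA (h ∘ f)
∘-InSharpFA N h h-⊓ {f} (M , M≗f) =
  InSharpFA-resp δ*-computes-h∘f (deterministic-InSharpFA s₀ (h ∘ (λ s → weighted (decode s) [])))
  where
  open TruncatedCounts M N
  open Forward M
  open Truncation N
  open Deterministic δ
  s₀ : Fin States
  s₀ = encode (inw M)

  h-resp-≃ : ∀ {x y} → x ≃ y → h x ≡ h y
  h-resp-≃ {x} {y} x≃y = trans (h-⊓ x) (trans (cong h x≃y) (sym (h-⊓ y)))

  δ*-computes-h∘f : ∀ w → h (weighted (decode (δ* s₀ w)) []) ≡ h (f w)
  δ*-computes-h∘f w = begin
    h (weighted (decode (δ* s₀ w)) [])
      ≡⟨ h-resp-≃ (sym (weighted-≃-δ* w (λ q → sym (decode-encode (inw M) q)))) ⟩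
    h (weighted (inw M) w)             ≡⟨ cong h (sym (⟦⟧≡weighted w)) ⟩
    h (⟦ M ⟧ w)                        ≡⟨ cong h (M≗f w) ⟩
    h (f w)                            ∎
    where open ≡-Reasoning

constant-above⇒⊓-invariant : ∀ c (h : ℕ → ℕ) → (∀ {x} → c < x → h x ≡ h (suc c)) → ∀ x → h x ≡ h (x ⊓ suc c)
constant-above⇒⊓-invariant c h h-stable x with x ≤? c
... | yes x≤c = cong h (sym (m≤n⇒m⊓n≡m (m≤n⇒m≤1+n x≤c)))
... | no  x≰c = trans (h-stable (≰⇒> x≰c)) (cong h (sym (m≥n⇒m⊓n≡n (≰⇒> x≰c))))

indicator : {A : Set} → Dec A → ℕ
indicator (yes _) = 1
indicator (no  _) = 0

indicator-no : {A : Set} → ¬ A → (a? : Dec A) → indicator a? ≡ 0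
indicator-no ¬a (yes a) = contradiction a ¬a
indicator-no ¬a (no  _) = refl

indicator-yes : {A : Set} → A → (a? : Dec A) → indicator a? ≡ 1
indicator-yes a (yes _)  = refl
indicator-yes a (no ¬a) = contradiction a ¬a

module _ {k} (f : List (Fin k) → ℕ) (c : ℕ) (w : List (Fin k)) where

  𝟙[≡]-indicator : 𝟙[ f ≡ c ] w ≡ indicator (f w ≟ c)
  𝟙[≡]-indicator with f w ≟ c
  ... | yes _ = refl
  ... | no  _ = refl

  𝟙[≤]-indicator : 𝟙[ f ≤ c ] w ≡ indicator (f w ≤? c)
  𝟙[≤]-indicator with f w ≤? c
  ... | yes _ = refl
  ... | no  _ = refl

  𝟙[≥]-indicator : 𝟙[ f ≥ c ] w ≡ indicator (c ≤? f w)
  𝟙[≥]-indicator with c ≤? f w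
  ... | yes _ = refl
  ... | no  _ = refl

lemma8 : ∀ {k : ℕ} (f : List (Fin k) → ℕ) → InSharpFA f → (c : ℕ) →
           InSharpFA (𝟙[ f ≡ c ]) × InSharpFA (𝟙[ f ≤ c ]) × InSharpFA (𝟙[ f ≥ c ])
lemma8 f f∈#FA c =
    InSharpFA-resp (sym ∘ 𝟙[≡]-indicator f c) (threshold (λ x → indicator (x ≟ c)) ≡-stable)
  , InSharpFA-resp (sym ∘ 𝟙[≤]-indicator f c) (threshold (λ x → indicator (x ≤? c)) ≤-stable)
  , InSharpFA-resp (sym ∘ 𝟙[≥]-indicator f c) (threshold (λ x → indicator (c ≤? x)) ≥-stable)
  where
  threshold : ∀ h → (∀ {x} → c < x → h x ≡ h (suc c)) → InSharpFA (h ∘ f)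
  threshold h h-stable = ∘-InSharpFA (suc c) h (constant-above⇒⊓-invariant c h h-stable) f∈#FA

  ≡-stable : ∀ {x} → c < x → indicator (x ≟ c) ≡ indicator (suc c ≟ c)
  ≡-stable c<x = trans (indicator-no (>⇒≢ c<x) _) (sym (indicator-no 1+n≢n _))

  ≤-stable : ∀ {x} → c < x → indicator (x ≤? c) ≡ indicator (suc c ≤? c)
  ≤-stable c<x = trans (indicator-no (<⇒≱ c<x) _) (sym (indicator-no (<⇒≱ (n<1+n c)) _))

  ≥-stable : ∀ {x} → c < x → indicator (c ≤? x) ≡ indicator (c ≤? suc c)
  ≥-stable c<x = trans (indicator-yes (<⇒≤ c<x) _) (sym (indicator-yes (n≤1+n c) _))
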